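{- Let $S=\{s_1>s_2>\dots>s_n\}$ be a set of items and let $S'$ be a subset of $S$ chosen uniformly at random among all subsets of $S$. Let $t,k$ be integers with $t\le k\le n$. Then $$\mathbb{E}[T_t(S')]\;\ge\;T_k(S)\sum_{r=1}^{k}\binom{k}{r}\frac{1}{2^k}\cdot\frac{\min(r,t)}{k}.$$
   Context: Each item has a nonnegative value; items are ordered by value ($s_1$ has the largest value). For a set of items $X$, $T_j(X)=\max_{T\subseteq X,\,|T|\le j}\sum_{x\in T}v(x)$.
   Formalization: Each item's value is a nonnegative rational number. -}

module Defs where

open import Data.Bool using (true; false)
open import Data.Nat as ℕ using (ℕ; zero; suc; _⊓_; _^_; _≤?_)
open import Data.Nat.Properties using (m^n≢0)
open import Data.Nat.Combinatorics using (_C_)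
open import Data.Integer using (+_)
open import Data.Fin using (Fin)
import Data.Fin as Fin
open import Data.Fin.Subset using (Subset; inside; outside; _⊆_; ∣_∣)
open import Data.Fin.Subset.Properties using (_⊆?_)
open import Data.Vec using (Vec; []; _∷_)
open import Data.List using (List; []; _∷_; _++_; map; filter; foldr; upTo)
open import Data.Rational using (ℚ; 0ℚ; _+_; _*_; _⊔_; _/_)
open import Relation.Nullary.Decidable using (_×-dec_)

sumℚ : List ℚ → ℚ
sumℚ = foldr _+_ 0ℚ

-- All 2^n subsets of the item set Fin n (item i = s_{i+1}).
allSubsets : (n : ℕ) → List (Subset n)
allSubsets zero    = [] ∷ []
allSubsets (suc n) = map (inside ∷_) (allSubsets n) ++ map (outside ∷_) (allSubsets n)

val : ∀ {n} → (Fin n → ℚ) → Subset n → ℚ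
val {zero}  v []            = 0ℚ
val {suc n} v (true  ∷ X)   = v Fin.zero + val (λ i → v (Fin.suc i)) X
val {suc n} v (false ∷ X)   = val (λ i → v (Fin.suc i)) X

-- T_j(X) = max over T ⊆ X with |T| ≤ j of Σ_{x∈T} v(x).
-- (The empty set is always admissible and values are nonnegative in the theorem,
--  so starting the fold at 0 gives exactly the maximum.)
T : ∀ {n} → (Fin n → ℚ) → ℕ → Subset n → ℚ
T {n} v j X =
  foldr _⊔_ 0ℚ (map (val v) (filter (λ Y → (Y ⊆? X) ×-dec (∣ Y ∣ ≤? j)) (allSubsets n)))

expectedT : ∀ {n} → (Fin n → ℚ) → ℕ → ℚ
expectedT {n} v t =
  sumℚ (map (T v t) (allSubsets n)) * ((+ 1 / (2 ^ n)) {{m^n≢0 2 n}})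

coef : ℕ → ℕ → ℚ
coef t zero    = 0ℚ
coef t (suc k) =
  sumℚ (map (λ r → ((+ (suc k C r) / (2 ^ suc k)) {{m^n≢0 2 (suc k)}}) * (+ (r ⊓ t) / suc k))
            (map suc (upTo (suc k))))

-- Let F(n, t) = Σ_{X ⊆ S} T_t(X) = 2ⁿ E[T_t(S')] and c(t, k) the coefficient, and induct on n.
-- Splitting the subsets of S by whether they contain s₁ gives
--   F(n+1, t+1) ≥ 2ⁿ v(s₁) + F(n, t) + F(n, t+1),
-- while T_{k+1}(S) ≤ v(s₁) + T_k(S ∖ s₁) and T_k(S ∖ s₁) ≤ k v(s₁) because s₁ is the largest item.
-- On the other side, writing k 2^k c(t, k) = Σ_r C(k,r) min(r,t) and applying Pascal's rule yields
--   2 (k+1) c(t+1, k+1) = k (c(t, k) + c(t+1, k)) + 1,   0 ≤ c(t, k) ≤ 1/2,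
-- and these two recursions combine to 2ⁿ c(t, k) T_k(S) ≤ F(n, t).

module Submission where

open import Defs
open import Data.Nat using (ℕ; zero; suc)
import Data.Nat as ℕ
import Data.Nat.Properties as ℕP
open import Data.Nat.Combinatorics using (_C_)
open import Data.Fin using (Fin)
import Data.Fin as Fin
open import Function using (_∘_; id)
open import Relation.Binary.PropositionalEquality
import Algebra.Properties.CommutativeMonoid.Sum as MonoidSum

module ℕΣ = MonoidSum ℕP.+-0-commutativeMonoid

module WeightedBinomial where
  open import Data.Nat
  open import Data.Nat.Properties
  open import Data.Nat.Combinatorics using (nCk+nC[k+1]≡[n+1]C[k+1]; k>n⇒nCk≡0)
  open import Data.Fin using (toℕ; inject₁; fromℕ)
  open import Data.Fin.Properties using (toℕ-inject₁; toℕ-fromℕ)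
  import Algebra.Properties.CommutativeSemiring.Binomial as Binomial
  open import Algebra.Definitions.RawSemiring +-*-rawSemiring using () renaming (_^_ to _^′_; _×_ to _×′_)
  open ℕΣ using (sum-syntax; sum⁺-syntax; sum-cong-≗; ∑-distrib-+; sum-init-last; sum-replicate-zero)
  open ≡-Reasoning

  ^′≡^ : ∀ m n → m ^′ n ≡ m ^ n
  ^′≡^ m zero    = refl
  ^′≡^ m (suc n) = cong (m *_) (^′≡^ m n)

  ×′≡* : ∀ m n → m ×′ n ≡ m * n
  ×′≡* zero    n = refl
  ×′≡* (suc m) n = cong (n +_) (×′≡* m n)

  sum-binomial : ∀ k → ∑[ r ≤ k ] (k C toℕ r) ≡ 2 ^ k
  sum-binomial k = begin
    ∑[ r ≤ k ] (k C toℕ r)                                    ≡⟨ sum-cong-≗ {suc k} term ⟨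
    ∑[ r ≤ k ] ((k C toℕ r) ×′ (1 ^′ toℕ r * 1 ^′ (k ∸ toℕ r))) ≡⟨ Binomial.theorem +-*-commutativeSemiring k 1 1 ⟨
    2 ^′ k                                                    ≡⟨ ^′≡^ 2 k ⟩
    2 ^ k                                                     ∎
    where
    1^′≡1 : ∀ m → 1 ^′ m ≡ 1
    1^′≡1 m = trans (^′≡^ 1 m) (^-zeroˡ m)
    term : ∀ (r : Fin (suc k)) → (k C toℕ r) ×′ (1 ^′ toℕ r * 1 ^′ (k ∸ toℕ r)) ≡ k C toℕ r
    term r = begin
      (k C toℕ r) ×′ (1 ^′ toℕ r * 1 ^′ (k ∸ toℕ r)) ≡⟨ ×′≡* (k C toℕ r) _ ⟩
      (k C toℕ r) * (1 ^′ toℕ r * 1 ^′ (k ∸ toℕ r))  ≡⟨ cong ((k C toℕ r) *_) (cong₂ _*_ (1^′≡1 (toℕ r)) (1^′≡1 (k ∸ toℕ r))) ⟩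
      (k C toℕ r) * 1                                ≡⟨ *-identityʳ _ ⟩
      k C toℕ r                                      ∎

  weightedBinomial : ℕ → ℕ → ℕ
  weightedBinomial t k = ∑[ r < k ] ((k C suc (toℕ r)) * (suc (toℕ r) ⊓ t))

  weightedBinomial-zero : ∀ k → weightedBinomial 0 k ≡ 0
  weightedBinomial-zero k = trans (sum-cong-≗ {k} (λ r → *-zeroʳ (k C suc (toℕ r)))) (sum-replicate-zero k)

  weightedBinomial-suc : ∀ t k →
    weightedBinomial (suc t) (suc k) ≡ 2 ^ k + weightedBinomial t k + weightedBinomial (suc t) k
  weightedBinomial-suc t k = begin
    ∑[ r ≤ k ] ((suc k C suc (toℕ r)) * suc (toℕ r ⊓ t))
      ≡⟨ sum-cong-≗ {suc k} (λ r → cong (_* suc (toℕ r ⊓ t)) (nCk+nC[k+1]≡[n+1]C[k+1] k (toℕ r))) ⟨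
    ∑[ r ≤ k ] ((k C toℕ r + k C suc (toℕ r)) * suc (toℕ r ⊓ t))
      ≡⟨ sum-cong-≗ {suc k} (λ r → *-distribʳ-+ (suc (toℕ r ⊓ t)) (k C toℕ r) (k C suc (toℕ r))) ⟩
    ∑[ r ≤ k ] ((k C toℕ r) * suc (toℕ r ⊓ t) + (k C suc (toℕ r)) * suc (toℕ r ⊓ t))
      ≡⟨ ∑-distrib-+ {suc k} (λ r → (k C toℕ r) * suc (toℕ r ⊓ t)) (λ r → (k C suc (toℕ r)) * suc (toℕ r ⊓ t)) ⟩
    ∑[ r ≤ k ] ((k C toℕ r) * suc (toℕ r ⊓ t)) + ∑[ r ≤ k ] ((k C suc (toℕ r)) * suc (toℕ r ⊓ t))
      ≡⟨ cong₂ _+_ lower upper ⟩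
    2 ^ k + weightedBinomial t k + weightedBinomial (suc t) k
      ∎
    where
    lower : ∑[ r ≤ k ] ((k C toℕ r) * suc (toℕ r ⊓ t)) ≡ 2 ^ k + weightedBinomial t k
    lower = begin
      ∑[ r ≤ k ] ((k C toℕ r) * suc (toℕ r ⊓ t))
        ≡⟨ sum-cong-≗ {suc k} (λ r → *-suc (k C toℕ r) (toℕ r ⊓ t)) ⟩
      ∑[ r ≤ k ] (k C toℕ r + (k C toℕ r) * (toℕ r ⊓ t))
        ≡⟨ ∑-distrib-+ {suc k} (λ r → k C toℕ r) (λ r → (k C toℕ r) * (toℕ r ⊓ t)) ⟩
      ∑[ r ≤ k ] (k C toℕ r) + ∑[ r ≤ k ] ((k C toℕ r) * (toℕ r ⊓ t))
        ≡⟨ cong₂ _+_ (sum-binomial k) (cong (_+ weightedBinomial t k) (*-zeroʳ (k C 0))) ⟩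
      2 ^ k + weightedBinomial t k
        ∎
    upper : ∑[ r ≤ k ] ((k C suc (toℕ r)) * suc (toℕ r ⊓ t)) ≡ weightedBinomial (suc t) k
    upper = begin
      ∑[ r ≤ k ] ((k C suc (toℕ r)) * suc (toℕ r ⊓ t))
        ≡⟨ sum-init-last {k} (λ r → (k C suc (toℕ r)) * suc (toℕ r ⊓ t)) ⟩
      ∑[ r < k ] ((k C suc (toℕ (inject₁ r))) * suc (toℕ (inject₁ r) ⊓ t)) + (k C suc (toℕ (fromℕ k))) * suc (toℕ (fromℕ k) ⊓ t)
        ≡⟨ cong₂ _+_ (sum-cong-≗ {k} (λ r → cong (λ i → (k C suc i) * suc (i ⊓ t)) (toℕ-inject₁ r)))
                     (cong (λ i → (k C suc i) * suc (i ⊓ t)) (toℕ-fromℕ k)) ⟩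
      weightedBinomial (suc t) k + (k C suc k) * suc (k ⊓ t)
        ≡⟨ cong (λ c → weightedBinomial (suc t) k + c * suc (k ⊓ t)) (k>n⇒nCk≡0 (n<1+n k)) ⟩
      weightedBinomial (suc t) k + 0
        ≡⟨ +-identityʳ _ ⟩
      weightedBinomial (suc t) k
        ∎

open import Algebra.Bundles using (CommutativeRing)
open import Data.Bool using (true; false)
open import Data.Vec using ([]; _∷_)
open import Data.Integer as ℤ using (+_)
import Data.Integer.Properties as ℤP
open import Data.Rational hiding (_⊓_; ∣_∣)
open import Data.Rational.Properties
import Data.Rational.Unnormalised as ℚᵘ
import Data.Rational.Unnormalised.Properties as ℚᵘP
open import Data.Rational.Solver using (module +-*-Solver)
open import Data.Fin.Subset using (Subset; inside; outside; _⊆_; ∣_∣; ⊤; ⊥)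
open import Data.Fin.Subset.Properties using (_⊆?_; out⊆; s⊆s; ⊆⊤; ⊥⊆; ∣⊥∣≡0)
open import Data.List using (List; []; _∷_; _++_; map; filter; foldr; length; applyUpTo; upTo)
open import Data.List.Properties using (map-∘; length-map; length-++)
open import Data.List.Membership.Propositional using (_∈_)
open import Data.List.Membership.Propositional.Properties using (∈-map⁺; ∈-map⁻; ∈-filter⁺; ∈-filter⁻; ∈-++⁺ˡ; ∈-++⁺ʳ)
open import Data.List.Relation.Unary.Any using (here; there)
open import Data.Product using (_×_; _,_; ∃; Σ-syntax)
open import Data.Sum using (inj₁; inj₂)
open import Relation.Nullary.Decidable using (_×-dec_)
open import Relation.Unary using (Decidable)
import Algebra.Properties.Semiring.Mult (CommutativeRing.semiring +-*-commutativeRing) as Mult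
open import Algebra.Properties.Semiring.Sum (CommutativeRing.semiring +-*-commutativeRing)
  using (sum; sum-syntax; sum-cong-≗; *-distribˡ-sum)

open WeightedBinomial using (weightedBinomial; weightedBinomial-zero; weightedBinomial-suc)
open +-*-Solver

-- The n-fold sum of 1, so that Algebra.Properties.Semiring.Mult supplies the homomorphism laws.
ι : ℕ → ℚ
ι n = n Mult.× 1ℚ

toℚᵘ-ι : ∀ n → toℚᵘ (ι n) ℚᵘ.≃ ℚᵘ.mkℚᵘ (+ n) 0
toℚᵘ-ι zero    = ℚᵘP.≃-refl
toℚᵘ-ι (suc n) = begin
  toℚᵘ (1ℚ + ι n)              ≈⟨ toℚᵘ-homo-+ 1ℚ (ι n) ⟩
  ℚᵘ.1ℚᵘ ℚᵘ.+ toℚᵘ (ι n)       ≈⟨ ℚᵘP.+-congʳ ℚᵘ.1ℚᵘ (toℚᵘ-ι n) ⟩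
  ℚᵘ.1ℚᵘ ℚᵘ.+ ℚᵘ.mkℚᵘ (+ n) 0  ≈⟨ ℚᵘ.*≡* (cong (ℤ._* + 1) (trans (cong (ℤ._+_ (+ 1)) (ℤP.*-identityʳ (+ n))) (sym (ℤP.pos-+ 1 n)))) ⟩
  ℚᵘ.mkℚᵘ (+ suc n) 0          ∎
  where open ℚᵘP.≃-Reasoning

/-*-ι : ∀ a d .{{_ : ℕ.NonZero d}} → (+ a / d) * ι d ≡ ι a
/-*-ι a (suc d) = toℚᵘ-injective (begin
  toℚᵘ ((+ a / suc d) * ι (suc d))          ≈⟨ toℚᵘ-homo-* (+ a / suc d) (ι (suc d)) ⟩
  toℚᵘ (+ a / suc d) ℚᵘ.* toℚᵘ (ι (suc d))  ≈⟨ ℚᵘP.*-cong (toℚᵘ-fromℚᵘ (ℚᵘ.mkℚᵘ (+ a) d)) (toℚᵘ-ι (suc d)) ⟩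
  ℚᵘ.mkℚᵘ (+ a) d ℚᵘ.* ℚᵘ.mkℚᵘ (+ suc d) 0  ≈⟨ ℚᵘ.*≡* (trans (ℤP.*-identityʳ _) (cong (λ m → + a ℤ.* + suc m) (sym (ℕP.*-identityʳ d)))) ⟩
  ℚᵘ.mkℚᵘ (+ a) 0                           ≈⟨ toℚᵘ-ι a ⟨
  toℚᵘ (ι a)                                ∎)
  where open ℚᵘP.≃-Reasoning

ι-nonNeg : ∀ n → 0ℚ ≤ ι n
ι-nonNeg zero    = ≤-refl
ι-nonNeg (suc n) = +-mono-≤ (<⇒≤ (positive⁻¹ 1ℚ)) (ι-nonNeg n)

ι-mono-≤ : ∀ {m n} → m ℕ.≤ n → ι m ≤ ι n
ι-mono-≤ {n = n} ℕ.z≤n = ι-nonNeg n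
ι-mono-≤ (ℕ.s≤s m≤n)   = +-monoʳ-≤ 1ℚ (ι-mono-≤ m≤n)

ι-sum : ∀ {n} (f : Fin n → ℕ) → ι (ℕΣ.sum f) ≡ sum (ι ∘ f)
ι-sum {zero}  f = refl
ι-sum {suc n} f = trans (Mult.×-homo-+ 1ℚ (f Fin.zero) (ℕΣ.sum (f ∘ Fin.suc))) (cong (_+_ (ι (f Fin.zero))) (ι-sum (f ∘ Fin.suc)))

ι-cancelˡ-≤ : ∀ n .{{_ : ℕ.NonZero n}} {p q} → ι n * p ≤ ι n * q → p ≤ q
ι-cancelˡ-≤ (suc n) = *-cancelˡ-≤-pos (ι (suc n)) {{positive (+-mono-<-≤ (positive⁻¹ 1ℚ) (ι-nonNeg n))}}

ι-cancelˡ-≡ : ∀ n .{{_ : ℕ.NonZero n}} {p q} → ι n * p ≡ ι n * q → p ≡ q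
ι-cancelˡ-≡ n eq = ≤-antisym (ι-cancelˡ-≤ n (≤-reflexive eq)) (ι-cancelˡ-≤ n (≤-reflexive (sym eq)))

*-monoˡ-≤-≥0 : ∀ {p q} r → 0ℚ ≤ r → p ≤ q → r * p ≤ r * q
*-monoˡ-≤-≥0 r 0≤r = *-monoˡ-≤-nonNeg r {{nonNegative 0≤r}}

0≤* : ∀ {p q} → 0ℚ ≤ p → 0ℚ ≤ q → 0ℚ ≤ p * q
0≤* {p} 0≤p 0≤q = ≤-trans (≤-reflexive (sym (*-zeroʳ p))) (*-monoˡ-≤-≥0 p 0≤p 0≤q)

p≤q⇒0≤q-p : ∀ {p q} → p ≤ q → 0ℚ ≤ q - p
p≤q⇒0≤q-p {p} p≤q = ≤-trans (≤-reflexive (sym (+-inverseʳ p))) (+-monoˡ-≤ (- p) p≤q)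

0≤q⇒p≤p+q : ∀ p {q} → 0ℚ ≤ q → p ≤ p + q
0≤q⇒p≤p+q p {q} 0≤q = ≤-trans (≤-reflexive (sym (+-identityʳ p))) (+-monoʳ-≤ p 0≤q)

-- The gap between the two sides is (1 - a) (k x - p).
[ka+1][x+p]≤[1+k][x+ap] : ∀ k {a x p} → a ≤ 1ℚ → p ≤ k * x → (k * a + 1ℚ) * (x + p) ≤ (1ℚ + k) * (x + a * p)
[ka+1][x+p]≤[1+k][x+ap] k {a} {x} {p} a≤1 p≤kx = begin
  (k * a + 1ℚ) * (x + p)                               ≤⟨ 0≤q⇒p≤p+q _ (0≤* (p≤q⇒0≤q-p a≤1) (p≤q⇒0≤q-p p≤kx)) ⟩
  (k * a + 1ℚ) * (x + p) + (1ℚ - a) * (k * x - p)      ≡⟨ solve 4 (λ k a x p → (k :* a :+ con 1ℚ) :* (x :+ p) :+ (con 1ℚ :- a) :* (k :* x :- p) := (con 1ℚ :+ k) :* (x :+ a :* p)) refl k a x p ⟩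
  (1ℚ + k) * (x + a * p)                               ∎
  where open ≤-Reasoning

2p≤1∧2q≤1⇒p+q≤1 : ∀ p q → ι 2 * p ≤ 1ℚ → ι 2 * q ≤ 1ℚ → p + q ≤ 1ℚ
2p≤1∧2q≤1⇒p+q≤1 p q 2p≤1 2q≤1 = ι-cancelˡ-≤ 2 (begin
  ι 2 * (p + q)       ≡⟨ *-distribˡ-+ (ι 2) p q ⟩
  ι 2 * p + ι 2 * q   ≤⟨ +-mono-≤ 2p≤1 2q≤1 ⟩
  1ℚ + 1ℚ             ≡⟨ *-identityʳ (ι 2) ⟨
  ι 2 * 1ℚ            ∎)
  where open ≤-Reasoning

module _ {A : Set} (f : A → ℚ) where

  sumℚ-++ : ∀ xs ys → sumℚ (map f (xs ++ ys)) ≡ sumℚ (map f xs) + sumℚ (map f ys)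
  sumℚ-++ []       ys = sym (+-identityˡ _)
  sumℚ-++ (x ∷ xs) ys = trans (cong (_+_ (f x)) (sumℚ-++ xs ys)) (sym (+-assoc (f x) _ _))

  sumℚ-nonNeg : ∀ xs → (∀ x → 0ℚ ≤ f x) → 0ℚ ≤ sumℚ (map f xs)
  sumℚ-nonNeg []       _    = ≤-refl
  sumℚ-nonNeg (x ∷ xs) 0≤f = +-mono-≤ (0≤f x) (sumℚ-nonNeg xs 0≤f)

  sumℚ-mono-≤ : ∀ {g : A → ℚ} xs → (∀ x → f x ≤ g x) → sumℚ (map f xs) ≤ sumℚ (map g xs)
  sumℚ-mono-≤ []       _   = ≤-refl
  sumℚ-mono-≤ (x ∷ xs) f≤g = +-mono-≤ (f≤g x) (sumℚ-mono-≤ xs f≤g)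

  sumℚ-+ : ∀ (g : A → ℚ) xs → sumℚ (map (λ x → f x + g x) xs) ≡ sumℚ (map f xs) + sumℚ (map g xs)
  sumℚ-+ g []       = refl
  sumℚ-+ g (x ∷ xs) = trans (cong (_+_ (f x + g x)) (sumℚ-+ g xs))
    (solve 4 (λ a b c d → (a :+ b) :+ (c :+ d) := (a :+ c) :+ (b :+ d)) refl (f x) (g x) _ _)

sumℚ-const : ∀ {A : Set} a (xs : List A) → sumℚ (map (λ _ → a) xs) ≡ ι (length xs) * a
sumℚ-const a []       = sym (*-zeroˡ a)
sumℚ-const a (x ∷ xs) = trans (cong (_+_ a) (sumℚ-const a xs))
  (solve 2 (λ a l → a :+ l :* a := (con 1ℚ :+ l) :* a) refl a (ι (length xs)))

sumℚ-applyUpTo : ∀ (f : ℕ → ℚ) g j → sumℚ (map f (applyUpTo g j)) ≡ ∑[ r < j ] f (g (Fin.toℕ r))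
sumℚ-applyUpTo f g zero    = refl
sumℚ-applyUpTo f g (suc j) = cong (_+_ (f (g 0))) (sumℚ-applyUpTo f (g ∘ suc) j)

coef-bridge : ∀ t k → ι k * ι (2 ℕ.^ k) * coef t k ≡ ι (weightedBinomial t k)
coef-bridge t zero    = *-zeroʳ (ι 0 * ι 1)
coef-bridge t (suc k) = begin
  M * coef t K                                ≡⟨ cong (M *_) (trans (cong sumℚ (sym (map-∘ {g = h} {f = suc} (upTo K)))) (sumℚ-applyUpTo (h ∘ suc) id K)) ⟩
  M * ∑[ r < K ] h (suc (Fin.toℕ r))        ≡⟨ *-distribˡ-sum {K} M (λ r → h (suc (Fin.toℕ r))) ⟩
  ∑[ r < K ] (M * h (suc (Fin.toℕ r)))      ≡⟨ sum-cong-≗ {K} (λ r → term (suc (Fin.toℕ r))) ⟩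
  ∑[ r < K ] ι ((K C suc (Fin.toℕ r)) ℕ.* (suc (Fin.toℕ r) ℕ.⊓ t)) ≡⟨ ι-sum {K} (λ r → (K C suc (Fin.toℕ r)) ℕ.* (suc (Fin.toℕ r) ℕ.⊓ t)) ⟨
  ι (weightedBinomial t K)                    ∎
  where
  open ≡-Reasoning
  K = suc k
  M = ι K * ι (2 ℕ.^ K)
  instance _ = ℕP.m^n≢0 2 K
  h : ℕ → ℚ
  h r = (+ (K C r) / 2 ℕ.^ K) * (+ (r ℕ.⊓ t) / K)
  term : ∀ r → M * h r ≡ ι ((K C r) ℕ.* (r ℕ.⊓ t))
  term r = begin
    M * h r                                                       ≡⟨ solve 4 (λ a b c d → (a :* b) :* (c :* d) := (c :* b) :* (d :* a)) refl (ι K) (ι (2 ℕ.^ K)) (+ (K C r) / 2 ℕ.^ K) (+ (r ℕ.⊓ t) / K) ⟩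
    ((+ (K C r) / 2 ℕ.^ K) * ι (2 ℕ.^ K)) * ((+ (r ℕ.⊓ t) / K) * ι K) ≡⟨ cong₂ _*_ (/-*-ι (K C r) (2 ℕ.^ K)) (/-*-ι (r ℕ.⊓ t) K) ⟩
    ι (K C r) * ι (r ℕ.⊓ t)                                       ≡⟨ Mult.×1-homo-* (K C r) (r ℕ.⊓ t) ⟨
    ι ((K C r) ℕ.* (r ℕ.⊓ t))                                       ∎

coef-zero : ∀ k → coef 0 k ≡ 0ℚ
coef-zero zero    = refl
coef-zero (suc k) = ι-cancelˡ-≡ (2 ℕ.^ suc k) {{ℕP.m^n≢0 2 (suc k)}} (ι-cancelˡ-≡ (suc k) (begin
  ι (suc k) * (ι (2 ℕ.^ suc k) * coef 0 (suc k)) ≡⟨ *-assoc (ι (suc k)) _ _ ⟨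
  ι (suc k) * ι (2 ℕ.^ suc k) * coef 0 (suc k)   ≡⟨ coef-bridge 0 (suc k) ⟩
  ι (weightedBinomial 0 (suc k))                 ≡⟨ cong ι (weightedBinomial-zero (suc k)) ⟩
  0ℚ                                             ≡⟨ *-zeroʳ (ι (suc k)) ⟨
  ι (suc k) * 0ℚ                                 ≡⟨ cong (ι (suc k) *_) (*-zeroʳ (ι (2 ℕ.^ suc k))) ⟨
  ι (suc k) * (ι (2 ℕ.^ suc k) * 0ℚ)             ∎))
  where open ≡-Reasoning

coef-suc : ∀ t k → ι (suc k) * (ι 2 * coef (suc t) (suc k)) ≡ ι k * (coef t k + coef (suc t) k) + 1ℚ
coef-suc t k = ι-cancelˡ-≡ (2 ℕ.^ k) {{ℕP.m^n≢0 2 k}} (begin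
  N * (ι (suc k) * (ι 2 * c))              ≡⟨ solve 4 (λ n k₁ two c → n :* (k₁ :* (two :* c)) := k₁ :* (two :* n) :* c) refl N (ι (suc k)) (ι 2) c ⟩
  ι (suc k) * (ι 2 * N) * c                ≡⟨ cong (λ m → ι (suc k) * m * c) (Mult.×1-homo-* 2 (2 ℕ.^ k)) ⟨
  ι (suc k) * ι (2 ℕ.^ suc k) * c          ≡⟨ coef-bridge (suc t) (suc k) ⟩
  ι (weightedBinomial (suc t) (suc k))     ≡⟨ cong ι (weightedBinomial-suc t k) ⟩
  ι (2 ℕ.^ k ℕ.+ W₁ ℕ.+ W₂)                ≡⟨ trans (Mult.×-homo-+ 1ℚ (2 ℕ.^ k ℕ.+ W₁) W₂) (cong (_+ ι W₂) (Mult.×-homo-+ 1ℚ (2 ℕ.^ k) W₁)) ⟩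
  N + ι W₁ + ι W₂                          ≡⟨ cong₂ (λ a b → N + a + b) (coef-bridge t k) (coef-bridge (suc t) k) ⟨
  N + ι k * N * c₁ + ι k * N * c₂          ≡⟨ solve 4 (λ k′ n c₁ c₂ → n :+ k′ :* n :* c₁ :+ k′ :* n :* c₂ := n :* (k′ :* (c₁ :+ c₂) :+ con 1ℚ)) refl (ι k) N c₁ c₂ ⟩
  N * (ι k * (c₁ + c₂) + 1ℚ)               ∎)
  where
  open ≡-Reasoning
  N = ι (2 ℕ.^ k)
  c = coef (suc t) (suc k)
  c₁ = coef t k
  c₂ = coef (suc t) k
  W₁ = weightedBinomial t k
  W₂ = weightedBinomial (suc t) k

coef-nonNeg : ∀ t k → 0ℚ ≤ coef t k
coef-nonNeg t       zero    = ≤-refl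
coef-nonNeg zero    (suc k) = ≤-reflexive (sym (coef-zero (suc k)))
coef-nonNeg (suc t) (suc k) = ι-cancelˡ-≤ 2 (ι-cancelˡ-≤ (suc k) (begin
  ι (suc k) * (ι 2 * 0ℚ)                   ≡⟨ trans (cong (ι (suc k) *_) (*-zeroʳ (ι 2))) (*-zeroʳ (ι (suc k))) ⟩
  0ℚ                                       ≤⟨ +-mono-≤ (0≤* (ι-nonNeg k) (+-mono-≤ (coef-nonNeg t k) (coef-nonNeg (suc t) k))) (<⇒≤ (positive⁻¹ 1ℚ)) ⟩
  ι k * (coef t k + coef (suc t) k) + 1ℚ   ≡⟨ coef-suc t k ⟨
  ι (suc k) * (ι 2 * coef (suc t) (suc k)) ∎))
  where open ≤-Reasoning

2*coef≤1 : ∀ t k → ι 2 * coef t k ≤ 1ℚ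
2*coef≤1 t       zero    = ≤-trans (≤-reflexive (*-zeroʳ (ι 2))) (<⇒≤ (positive⁻¹ 1ℚ))
2*coef≤1 zero    (suc k) = ≤-trans (≤-reflexive (trans (cong (ι 2 *_) (coef-zero (suc k))) (*-zeroʳ (ι 2)))) (<⇒≤ (positive⁻¹ 1ℚ))
2*coef≤1 (suc t) (suc k) = ι-cancelˡ-≤ (suc k) (begin
  ι (suc k) * (ι 2 * coef (suc t) (suc k))  ≡⟨ coef-suc t k ⟩
  ι k * (coef t k + coef (suc t) k) + 1ℚ    ≤⟨ +-monoˡ-≤ 1ℚ (*-monoˡ-≤-≥0 (ι k) (ι-nonNeg k) (2p≤1∧2q≤1⇒p+q≤1 (coef t k) (coef (suc t) k) (2*coef≤1 t k) (2*coef≤1 (suc t) k))) ⟩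
  ι k * 1ℚ + 1ℚ                             ≡⟨ solve 1 (λ k′ → k′ :* con 1ℚ :+ con 1ℚ := (con 1ℚ :+ k′) :* con 1ℚ) refl (ι k) ⟩
  ι (suc k) * 1ℚ                            ∎)
  where open ≤-Reasoning

coef+coef≤1 : ∀ t k → coef t k + coef (suc t) k ≤ 1ℚ
coef+coef≤1 t k = 2p≤1∧2q≤1⇒p+q≤1 (coef t k) (coef (suc t) k) (2*coef≤1 t k) (2*coef≤1 (suc t) k)

coef-step : ∀ t k {x p} → p ≤ ι k * x →
  ι 2 * coef (suc t) (suc k) * (x + p) ≤ x + (coef t k + coef (suc t) k) * p
coef-step t k {x} {p} p≤kx = ι-cancelˡ-≤ (suc k) (begin
  ι (suc k) * (ι 2 * c * (x + p))   ≡⟨ solve 4 (λ k′ two c y → k′ :* (two :* c :* y) := k′ :* (two :* c) :* y) refl (ι (suc k)) (ι 2) c (x + p) ⟩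
  ι (suc k) * (ι 2 * c) * (x + p)   ≡⟨ cong (_* (x + p)) (coef-suc t k) ⟩
  (ι k * a + 1ℚ) * (x + p)          ≤⟨ [ka+1][x+p]≤[1+k][x+ap] (ι k) (coef+coef≤1 t k) p≤kx ⟩
  ι (suc k) * (x + a * p)           ∎)
  where
  open ≤-Reasoning
  c = coef (suc t) (suc k)
  a = coef t k + coef (suc t) k

allSubsets-complete : ∀ {n} (Y : Subset n) → Y ∈ allSubsets n
allSubsets-complete []                = here refl
allSubsets-complete {suc n} (true ∷ Y)  = ∈-++⁺ˡ (∈-map⁺ (inside ∷_) (allSubsets-complete Y))
allSubsets-complete {suc n} (false ∷ Y) = ∈-++⁺ʳ (map (inside ∷_) (allSubsets n)) (∈-map⁺ (outside ∷_) (allSubsets-complete Y))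

length-allSubsets : ∀ n → length (allSubsets n) ≡ 2 ℕ.^ n
length-allSubsets zero    = refl
length-allSubsets (suc n) = begin
  length (map (inside ∷_) A ++ map (outside ∷_) A)      ≡⟨ length-++ (map (inside ∷_) A) ⟩
  length (map (inside ∷_) A) ℕ.+ length (map (outside ∷_) A) ≡⟨ cong₂ ℕ._+_ (length-map _ A) (length-map _ A) ⟩
  length A ℕ.+ length A                                  ≡⟨ cong₂ ℕ._+_ (length-allSubsets n) (trans (length-allSubsets n) (sym (ℕP.+-identityʳ _))) ⟩
  2 ℕ.^ suc n                                            ∎
  where
  open ≡-Reasoning
  A = allSubsets n

foldr-⊔-nonNeg : ∀ xs → 0ℚ ≤ foldr _⊔_ 0ℚ xs
foldr-⊔-nonNeg []       = ≤-refl
foldr-⊔-nonNeg (x ∷ xs) = ≤-trans (foldr-⊔-nonNeg xs) (p≤q⊔p x _)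

∈⇒≤-foldr-⊔ : ∀ {x} xs → x ∈ xs → x ≤ foldr _⊔_ 0ℚ xs
∈⇒≤-foldr-⊔ (y ∷ xs) (here refl) = p≤p⊔q y _
∈⇒≤-foldr-⊔ (y ∷ xs) (there x∈xs) = ≤-trans (∈⇒≤-foldr-⊔ xs x∈xs) (p≤q⊔p y _)

foldr-⊔-lub : ∀ {c} xs → 0ℚ ≤ c → (∀ {x} → x ∈ xs → x ≤ c) → foldr _⊔_ 0ℚ xs ≤ c
foldr-⊔-lub []       0≤c ub = 0≤c
foldr-⊔-lub (y ∷ xs) 0≤c ub = ⊔-lub (ub (here refl)) (foldr-⊔-lub xs 0≤c (ub ∘ there))

module _ {n} (v : Fin n → ℚ) where

  admissible? : ∀ j X → Decidable (λ (Y : Subset n) → Y ⊆ X × ∣ Y ∣ ℕ.≤ j)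
  admissible? j X Y = (Y ⊆? X) ×-dec (∣ Y ∣ ℕ.≤? j)

  admissibleValues : ℕ → Subset n → List ℚ
  admissibleValues j X = map (val v) (filter (admissible? j X) (allSubsets n))

  T-nonNeg : ∀ j X → 0ℚ ≤ T v j X
  T-nonNeg j X = foldr-⊔-nonNeg (admissibleValues j X)

  val≤T : ∀ {j X Y} → Y ⊆ X → ∣ Y ∣ ℕ.≤ j → val v Y ≤ T v j X
  val≤T {j} {X} {Y} Y⊆X ∣Y∣≤j = ∈⇒≤-foldr-⊔ (admissibleValues j X)
    (∈-map⁺ (val v) (∈-filter⁺ (admissible? j X) (allSubsets-complete Y) (Y⊆X , ∣Y∣≤j)))

  T-lub : ∀ {j X c} → 0ℚ ≤ c → (∀ {Y} → Y ⊆ X → ∣ Y ∣ ℕ.≤ j → val v Y ≤ c) → T v j X ≤ c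
  T-lub {j} {X} {c} 0≤c ub = foldr-⊔-lub (admissibleValues j X) 0≤c (bound ∘ ∈-map⁻ (val v))
    where
    bound : ∀ {x} → ∃ (λ Y → Y ∈ filter (admissible? j X) (allSubsets n) × x ≡ val v Y) → x ≤ c
    bound (Y , Y∈ , refl) with ∈-filter⁻ (admissible? j X) {xs = allSubsets n} Y∈
    ... | _ , (Y⊆X , ∣Y∣≤j) = ub Y⊆X ∣Y∣≤j

val-⊥ : ∀ {n} (v : Fin n → ℚ) → val v ⊥ ≡ 0ℚ
val-⊥ {zero}  v = refl
val-⊥ {suc n} v = val-⊥ (v ∘ Fin.suc)

val≤size*bound : ∀ {n} (v : Fin n → ℚ) {b} (Y : Subset n) → (∀ i → v i ≤ b) → val v Y ≤ ι ∣ Y ∣ * b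
val≤size*bound v {b} []          v≤b = ≤-reflexive (sym (*-zeroˡ b))
val≤size*bound v {b} (true ∷ Y)  v≤b = begin
  v Fin.zero + val (v ∘ Fin.suc) Y ≤⟨ +-mono-≤ (v≤b Fin.zero) (val≤size*bound (v ∘ Fin.suc) Y (v≤b ∘ Fin.suc)) ⟩
  b + ι ∣ Y ∣ * b                  ≡⟨ solve 2 (λ b m → b :+ m :* b := (con 1ℚ :+ m) :* b) refl b (ι ∣ Y ∣) ⟩
  (1ℚ + ι ∣ Y ∣) * b               ∎
  where open ≤-Reasoning
val≤size*bound v     (false ∷ Y) v≤b = val≤size*bound (v ∘ Fin.suc) Y (v≤b ∘ Fin.suc)

val-remove : ∀ {n} (v : Fin n → ℚ) (Y : Subset n) {m} → ∣ Y ∣ ≡ suc m →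
  Σ[ i ∈ Fin n ] Σ[ Z ∈ Subset n ] ∣ Z ∣ ≡ m × val v Y ≡ v i + val v Z
val-remove v (true ∷ Y)  eq = Fin.zero , outside ∷ Y , ℕP.suc-injective eq , refl
val-remove v (false ∷ Y) eq with val-remove (v ∘ Fin.suc) Y eq
... | i , Z , ∣Z∣≡m , split = Fin.suc i , outside ∷ Z , ∣Z∣≡m , split

T≤k*bound : ∀ {n} (v : Fin n → ℚ) {b} k X → 0ℚ ≤ b → (∀ i → v i ≤ b) → T v k X ≤ ι k * b
T≤k*bound v k X 0≤b v≤b = T-lub v (0≤* (ι-nonNeg k) 0≤b)
  (λ {Y} _ ∣Y∣≤k → ≤-trans (val≤size*bound v Y v≤b) (*-monoʳ-≤-nonNeg _ {{nonNegative 0≤b}} (ι-mono-≤ ∣Y∣≤k)))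

module _ {n} (v : Fin (suc n) → ℚ) where
  private
    x = v Fin.zero
    v′ = v ∘ Fin.suc

  T-outside : ∀ t X → T v′ t X ≤ T v t (outside ∷ X)
  T-outside t X = T-lub v′ (T-nonNeg v t (outside ∷ X)) (λ Y⊆X ∣Y∣≤t → val≤T v (out⊆ Y⊆X) ∣Y∣≤t)

  T-inside : ∀ t X → x + T v′ t X ≤ T v (suc t) (inside ∷ X)
  T-inside t X = begin
    x + T v′ t X   ≤⟨ +-monoʳ-≤ x (T-lub v′ 0≤c-x (λ Y⊆X ∣Y∣≤t → shift (via Y⊆X ∣Y∣≤t))) ⟩
    x + (c - x)    ≡⟨ solve 2 (λ a c → a :+ (c :- a) := c) refl x c ⟩
    c              ∎
    where
    open ≤-Reasoning
    c = T v (suc t) (inside ∷ X)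
    via : ∀ {Y} → Y ⊆ X → ∣ Y ∣ ℕ.≤ t → x + val v′ Y ≤ c
    via Y⊆X ∣Y∣≤t = val≤T v (s⊆s Y⊆X) (ℕ.s≤s ∣Y∣≤t)
    shift : ∀ {a b} → a + b ≤ c → b ≤ c - a
    shift {a} {b} a+b≤c = ≤-trans (≤-reflexive (solve 2 (λ a b → b := a :+ b :- a) refl a b)) (+-monoˡ-≤ (- a) a+b≤c)
    0≤c-x : 0ℚ ≤ c - x
    0≤c-x = ≤-trans (≤-reflexive (sym (val-⊥ v′))) (shift (via ⊥⊆ (subst (ℕ._≤ t) (sym (∣⊥∣≡0 n)) ℕ.z≤n)))

  T-⊤-suc : 0ℚ ≤ x → (∀ i → v′ i ≤ x) → ∀ k → T v (suc k) ⊤ ≤ x + T v′ k ⊤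
  T-⊤-suc 0≤x v′≤x k = T-lub v (+-mono-≤ 0≤x (T-nonNeg v′ k ⊤)) bound
    where
    T′≤x+T′ : T v′ k ⊤ ≤ x + T v′ k ⊤
    T′≤x+T′ = ≤-trans (≤-reflexive (sym (+-identityˡ _))) (+-monoˡ-≤ (T v′ k ⊤) 0≤x)
    bound : ∀ {Y} → Y ⊆ ⊤ → ∣ Y ∣ ℕ.≤ suc k → val v Y ≤ x + T v′ k ⊤
    bound {true ∷ Y}  _ (ℕ.s≤s ∣Y∣≤k) = +-monoʳ-≤ x (val≤T v′ ⊆⊤ ∣Y∣≤k)
    bound {false ∷ Y} _ ∣Y∣≤1+k with ℕP.m≤n⇒m<n∨m≡n ∣Y∣≤1+k
    ... | inj₁ (ℕ.s≤s ∣Y∣≤k) = ≤-trans (val≤T v′ ⊆⊤ ∣Y∣≤k) T′≤x+T′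
    -- Y has k+1 items, none of them s₁: trade one of them for s₁.
    ... | inj₂ ∣Y∣≡1+k with val-remove v′ Y ∣Y∣≡1+k
    ...   | i , Z , ∣Z∣≡k , split = ≤-trans (≤-reflexive split) (+-mono-≤ (v′≤x i) (val≤T v′ ⊆⊤ (ℕP.≤-reflexive ∣Z∣≡k)))

sumT : ∀ {n} → (Fin n → ℚ) → ℕ → ℚ
sumT {n} v t = sumℚ (map (T v t) (allSubsets n))

sumT-suc : ∀ {n} (v : Fin (suc n) → ℚ) t →
  ι (2 ℕ.^ n) * v Fin.zero + sumT (v ∘ Fin.suc) t + sumT (v ∘ Fin.suc) (suc t) ≤ sumT v (suc t)
sumT-suc {n} v t = begin
  ι (2 ℕ.^ n) * x + sumT v′ t + sumT v′ (suc t)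
    ≡⟨ cong (λ m → ι m * x + sumT v′ t + sumT v′ (suc t)) (length-allSubsets n) ⟨
  ι (length A) * x + sumT v′ t + sumT v′ (suc t)
    ≡⟨ cong (λ s → s + sumT v′ t + sumT v′ (suc t)) (sumℚ-const x A) ⟨
  sumℚ (map (λ _ → x) A) + sumT v′ t + sumT v′ (suc t)
    ≡⟨ cong (_+ sumT v′ (suc t)) (sumℚ-+ (λ _ → x) (T v′ t) A) ⟨
  sumℚ (map (λ X → x + T v′ t X) A) + sumT v′ (suc t)
    ≤⟨ +-mono-≤ (sumℚ-mono-≤ _ A (T-inside v t)) (sumℚ-mono-≤ _ A (T-outside v (suc t))) ⟩
  sumℚ (map (T v (suc t) ∘ (inside ∷_)) A) + sumℚ (map (T v (suc t) ∘ (outside ∷_)) A)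
    ≡⟨ cong₂ _+_ (cong sumℚ (map-∘ A)) (cong sumℚ (map-∘ A)) ⟩
  sumℚ (map (T v (suc t)) (map (inside ∷_) A)) + sumℚ (map (T v (suc t)) (map (outside ∷_) A))
    ≡⟨ sumℚ-++ (T v (suc t)) (map (inside ∷_) A) (map (outside ∷_) A) ⟨
  sumT v (suc t)
    ∎
  where
  open ≤-Reasoning
  A = allSubsets n
  x = v Fin.zero
  v′ = v ∘ Fin.suc

sumT-nonNeg : ∀ {n} (v : Fin n → ℚ) t → 0ℚ ≤ sumT v t
sumT-nonNeg {n} v t = sumℚ-nonNeg (T v t) (allSubsets n) (T-nonNeg v t)

coef≡0⇒2ⁿ*coef*T≤sumT : ∀ {n} (v : Fin n → ℚ) t k → coef t k ≡ 0ℚ → ι (2 ℕ.^ n) * (coef t k * T v k ⊤) ≤ sumT v t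
coef≡0⇒2ⁿ*coef*T≤sumT {n} v t k coef≡0 = begin
  ι (2 ℕ.^ n) * (coef t k * T v k ⊤) ≡⟨ cong (λ c → ι (2 ℕ.^ n) * (c * T v k ⊤)) coef≡0 ⟩
  ι (2 ℕ.^ n) * (0ℚ * T v k ⊤)       ≡⟨ trans (cong (ι (2 ℕ.^ n) *_) (*-zeroˡ (T v k ⊤))) (*-zeroʳ (ι (2 ℕ.^ n))) ⟩
  0ℚ                                 ≤⟨ sumT-nonNeg v t ⟩
  sumT v t                           ∎
  where open ≤-Reasoning

2ⁿ*coef*T≤sumT : ∀ n (v : Fin n → ℚ) → (∀ i → 0ℚ ≤ v i) → (∀ i j → i Fin.≤ j → v j ≤ v i) →
  ∀ t k → k ℕ.≤ n → ι (2 ℕ.^ n) * (coef t k * T v k ⊤) ≤ sumT v t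
2ⁿ*coef*T≤sumT n       v 0≤v sorted t       zero    _ = coef≡0⇒2ⁿ*coef*T≤sumT v t 0 refl
2ⁿ*coef*T≤sumT (suc n) v 0≤v sorted zero    (suc k) _ = coef≡0⇒2ⁿ*coef*T≤sumT v 0 (suc k) (coef-zero (suc k))
2ⁿ*coef*T≤sumT (suc n) v 0≤v sorted (suc t) (suc k) (ℕ.s≤s k≤n) = begin
  ι (2 ℕ.^ suc n) * (c * T v (suc k) ⊤)
    ≤⟨ *-monoˡ-≤-≥0 _ (ι-nonNeg (2 ℕ.^ suc n)) (*-monoˡ-≤-≥0 c (coef-nonNeg (suc t) (suc k)) (T-⊤-suc v 0≤x v′≤x k)) ⟩
  ι (2 ℕ.^ suc n) * (c * (x + P))
    ≡⟨ cong (_* (c * (x + P))) (Mult.×1-homo-* 2 (2 ℕ.^ n)) ⟩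
  ι 2 * N * (c * (x + P))
    ≡⟨ solve 4 (λ two N c y → two :* N :* (c :* y) := N :* (two :* c :* y)) refl (ι 2) N c (x + P) ⟩
  N * (ι 2 * c * (x + P))
    ≤⟨ *-monoˡ-≤-≥0 N (ι-nonNeg (2 ℕ.^ n)) (coef-step t k (T≤k*bound v′ k ⊤ 0≤x v′≤x)) ⟩
  N * (x + (c₁ + c₂) * P)
    ≡⟨ solve 5 (λ N x c₁ c₂ P → N :* (x :+ (c₁ :+ c₂) :* P) := N :* x :+ N :* (c₁ :* P) :+ N :* (c₂ :* P)) refl N x c₁ c₂ P ⟩
  N * x + N * (c₁ * P) + N * (c₂ * P)
    ≤⟨ +-mono-≤ (+-monoʳ-≤ (N * x) (2ⁿ*coef*T≤sumT n v′ (0≤v ∘ Fin.suc) sorted′ t k k≤n))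
                (2ⁿ*coef*T≤sumT n v′ (0≤v ∘ Fin.suc) sorted′ (suc t) k k≤n) ⟩
  N * x + sumT v′ t + sumT v′ (suc t)
    ≤⟨ sumT-suc v t ⟩
  sumT v (suc t)
    ∎
  where
  open ≤-Reasoning
  x = v Fin.zero
  v′ = v ∘ Fin.suc
  0≤x = 0≤v Fin.zero
  v′≤x : ∀ i → v′ i ≤ x
  v′≤x i = sorted Fin.zero (Fin.suc i) ℕ.z≤n
  sorted′ : ∀ i j → i Fin.≤ j → v′ j ≤ v′ i
  sorted′ i j i≤j = sorted (Fin.suc i) (Fin.suc j) (ℕ.s≤s i≤j)
  N = ι (2 ℕ.^ n)
  P = T v′ k ⊤
  c = coef (suc t) (suc k)
  c₁ = coef t k
  c₂ = coef (suc t) k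

lemma3 : (n : ℕ) (v : Fin n → ℚ)
         → (∀ i → 0ℚ ≤ v i)
         → (∀ i j → i Fin.≤ j → v j ≤ v i)
         → (t k : ℕ) → t ℕ.≤ k → k ℕ.≤ n
         → T v k ⊤ * coef t k ≤ expectedT v t
lemma3 n v 0≤v sorted t k _ k≤n = begin
  T v k ⊤ * coef t k                ≡⟨ *-identityʳ _ ⟨
  T v k ⊤ * coef t k * 1ℚ           ≡⟨ cong (T v k ⊤ * coef t k *_) (/-*-ι 1 (2 ℕ.^ n)) ⟨
  T v k ⊤ * coef t k * (u * N)      ≡⟨ solve 4 (λ P c u N → P :* c :* (u :* N) := N :* (c :* P) :* u) refl (T v k ⊤) (coef t k) u N ⟩
  N * (coef t k * T v k ⊤) * u      ≤⟨ *-monoʳ-≤-nonNeg u {{normalize-nonNeg 1 (2 ℕ.^ n)}} (2ⁿ*coef*T≤sumT n v 0≤v sorted t k k≤n) ⟩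
  sumT v t * u                      ∎
  where
  open ≤-Reasoning
  instance _ = ℕP.m^n≢0 2 n
  N = ι (2 ℕ.^ n)
  u = + 1 / 2 ℕ.^ n
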